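{- The axioms of domain semirings provide a finite equational axiomatisation of the equational theory of $\operatorname{Rel}(;,+,0,1,\mathrm{D})$: for all $\{;,+,0,1,\mathrm{D}\}$-terms $s,t$, the equation $s=t$ holds in every algebra in $\operatorname{Rel}(;,+,0,1,\mathrm{D})$ if and only if it holds in every domain semiring.
   Context: $\operatorname{Rel}(;,+,0,1,\mathrm{D})$ is the class of algebras isomorphic to a set of binary relations on a common base $X$ closed under composition $R;S=\{(x,y):\exists z\,(x,z)\in R,(z,y)\in S\}$, union $+$, domain $\mathrm{D}(R)=\{(x,x):\exists y\,(x,y)\in R\}$, and containing $0=\emptyset$ and $1=$ identity on $X$. A domain semiring (in the sense of Desharnais and Struth's internal axiomatisation) is an algebra $(S,+,;,0,1,\mathrm{D})$ such that $(S,+,;,0,1)$ is an idempotent semiring ($+$ associative, commutative, idempotent with identity $0$; $;$ associative with identity $1$; $;$ distributes over $+$ on both sides; $0$ is absorbing for $;$) and which satisfies $\mathrm{D}(x);x=x$, $\mathrm{D}(x;y)=\mathrm{D}(x;\mathrm{D}(y))$, $\mathrm{D}(x)+1=1$, $\mathrm{D}(0)=0$, and $\mathrm{D}(x+y)=\mathrm{D}(x)+\mathrm{D}(y)$. -}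

module Defs where

open import Level using (Level; _⊔_; suc)
open import Data.Nat using (ℕ)
open import Data.Product using (Σ; ∃; _×_; _,_)
open import Data.Sum using (_⊎_)
open import Data.Empty.Polymorphic using (⊥)
open import Relation.Binary.PropositionalEquality using (_≡_)
open import Relation.Binary.Structures using (IsEquivalence)
open import Algebra.Structures using (IsSemiring)
open import Function.Bundles using (_⇔_)

data Term : Set where
  var  : ℕ → Term
  _⨾_  : Term → Term → Term
  _⊕_  : Term → Term → Term
  𝟘    : Term
  𝟙    : Term
  dom  : Term → Term

record DomainSemiring (c ℓ : Level) : Set (suc (c ⊔ ℓ)) where
  infixl 7 _·_
  infixl 6 _+_
  infix  4 _≈_
  field
    Carrier : Set c
    _≈_     : Carrier → Carrier → Set ℓ
    _+_     : Carrier → Carrier → Carrier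
    _·_     : Carrier → Carrier → Carrier
    0#      : Carrier
    1#      : Carrier
    D       : Carrier → Carrier
    isSemiring : IsSemiring _≈_ _+_ _·_ 0# 1#
    +-idem  : ∀ x → x + x ≈ x
    D-cong  : ∀ {x y} → x ≈ y → D x ≈ D y
    D-left  : ∀ x → D x · x ≈ x
    D-loc   : ∀ x y → D (x · y) ≈ D (x · D y)
    D-sub   : ∀ x → D x + 1# ≈ 1#
    D-zero  : D 0# ≈ 0#
    D-add   : ∀ x y → D (x + y) ≈ D x + D y

  open IsSemiring isSemiring public using (isEquivalence)

module _ {c ℓ : Level} (S : DomainSemiring c ℓ) where
  open DomainSemiring S

  ⟦_⟧DS : Term → (ℕ → Carrier) → Carrier
  ⟦ var i ⟧DS  v = v i
  ⟦ s ⨾ t ⟧DS  v = ⟦ s ⟧DS v · ⟦ t ⟧DS v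
  ⟦ s ⊕ t ⟧DS  v = ⟦ s ⟧DS v + ⟦ t ⟧DS v
  ⟦ 𝟘 ⟧DS      v = 0#
  ⟦ 𝟙 ⟧DS      v = 1#
  ⟦ dom s ⟧DS  v = D (⟦ s ⟧DS v)

DSValid : (c ℓ : Level) → Term → Term → Set (suc (c ⊔ ℓ))
DSValid c ℓ s t =
  (S : DomainSemiring c ℓ) (v : ℕ → DomainSemiring.Carrier S) →
  DomainSemiring._≈_ S (⟦_⟧DS S s v) (⟦_⟧DS S t v)

BinRel : {a : Level} → Set a → Set (suc a)
BinRel {a} X = X → X → Set a

module _ {a : Level} {X : Set a} where

  _≐_ : BinRel X → BinRel X → Set a
  R ≐ S = ∀ x y → R x y ⇔ S x y

  _⨾ʳ_ : BinRel X → BinRel X → BinRel X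
  (R ⨾ʳ S) x y = ∃ λ z → R x z × S z y

  _∪ʳ_ : BinRel X → BinRel X → BinRel X
  (R ∪ʳ S) x y = R x y ⊎ S x y

  ∅ʳ : BinRel X
  ∅ʳ x y = ⊥

  idʳ : BinRel X
  idʳ x y = x ≡ y

  Dʳ : BinRel X → BinRel X
  Dʳ R x y = (x ≡ y) × ∃ λ z → R x z

record RelAlgebra (a : Level) : Set (suc (suc a)) where
  field
    Base     : Set a
    Member   : BinRel Base → Set (suc a)
    -- membership is extensional (𝒜 is a set of relations, i.e. of sets of pairs)
    Member-resp : ∀ {R S} → R ≐ S → Member R → Member S
    ⨾-closed : ∀ {R S} → Member R → Member S → Member (R ⨾ʳ S)
    ∪-closed : ∀ {R S} → Member R → Member S → Member (R ∪ʳ S)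
    D-closed : ∀ {R} → Member R → Member (Dʳ R)
    ∅-mem    : Member ∅ʳ
    id-mem   : Member idʳ

  Element : Set (suc a)
  Element = Σ (BinRel Base) Member

module _ {a : Level} (𝒜 : RelAlgebra a) where
  open RelAlgebra 𝒜

  ⟦_⟧Rel : Term → (ℕ → Element) → BinRel Base
  ⟦ var i ⟧Rel v with v i
  ... | R , _ = R
  ⟦ s ⨾ t ⟧Rel v = ⟦ s ⟧Rel v ⨾ʳ ⟦ t ⟧Rel v
  ⟦ s ⊕ t ⟧Rel v = ⟦ s ⟧Rel v ∪ʳ ⟦ t ⟧Rel v
  ⟦ 𝟘 ⟧Rel     v = ∅ʳ
  ⟦ 𝟙 ⟧Rel     v = idʳ
  ⟦ dom s ⟧Rel v = Dʳ (⟦ s ⟧Rel v)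

-- Validity of equations is invariant under isomorphism, so it suffices to
-- quantify over the concrete relation algebras themselves.
RelValid : (a : Level) → Term → Term → Set (suc (suc a))
RelValid a s t =
  (𝒜 : RelAlgebra a) (v : ℕ → RelAlgebra.Element 𝒜) →
  ⟦_⟧Rel 𝒜 s v ≐ ⟦_⟧Rel 𝒜 t v

module Submission where

-- The equational logic _≃_ of the domain-semiring axioms
-- has the term algebra modulo _≃_ as a domain semiring at every level, so an
-- equation valid in all domain semirings is derivable; and every rule of _≃_
-- preserves equality of relations, so derivable equations hold in Rel.
--
-- Forests of letters denote domain elements ("tests") and
-- paths, i.e. words of letters guarded by forests, denote products of letters
-- and tests.  Every term equals a finite sum of paths, its normal form, in
-- every domain semiring.  In one canonical relational model, whose states are
-- paths and in which a letter walks down a matching branch of the current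
-- forest, every normal-form summand p of s yields a pair in ⟦ s ⟧; and every
-- pair in ⟦ t ⟧ comes from a path lying below t in every domain semiring.  So
-- if s = t holds relationally, every summand of s, hence s itself, lies below
-- t in every domain semiring; by symmetry s = t there.

open import Defs
open import Level using (Level; Lift; lift; lower) renaming (suc to lsuc)
open import Data.Nat using (ℕ)
open import Data.Unit using (⊤; tt)
open import Data.List using (List; []; _∷_; _++_; map)
open import Data.List.Relation.Unary.Any using (here; there)
open import Data.List.Membership.Propositional using (_∈_)
open import Data.List.Membership.Propositional.Properties using (∈-++⁻; ∈-map⁻)
open import Data.Product using (Σ; _×_; _,_)
open import Data.Product.Function.NonDependent.Propositional using (_×-⇔_)
import Data.Product.Function.Dependent.Propositional as Σ-Function
open import Data.Sum using (inj₁; inj₂)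
open import Data.Sum.Function.Propositional using (_⊎-⇔_)
open import Relation.Binary.PropositionalEquality as ≡ using (_≡_; cong; cong₂; subst)
open import Relation.Binary.Bundles using (Setoid)
import Relation.Binary.Reasoning.Setoid as SetoidReasoning
open import Algebra.Structures using (IsSemiring)
open import Function.Bundles using (_⇔_; mk⇔; Equivalence)
open import Function.Related.Propositional using (equivalence)
import Function.Properties.Equivalence as ⇔

-- Order and domain elements in an arbitrary domain semiring

module DomainSemiringProperties {c ℓ : Level} (S : DomainSemiring c ℓ) where
  open DomainSemiring S
  open IsSemiring isSemiring
    using (+-assoc; +-comm; +-cong; +-identityˡ; *-cong; *-identityˡ; *-identityʳ;
           distribˡ; distribʳ; refl; sym; trans)

  setoid : Setoid c ℓ
  setoid = record { isEquivalence = isEquivalence }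
  open SetoidReasoning setoid

  infix 4 _≤_
  _≤_ : Carrier → Carrier → Set ℓ
  x ≤ y = x + y ≈ y

  ≤-reflexive : ∀ {x y} → x ≈ y → x ≤ y
  ≤-reflexive {x} {y} e = trans (+-cong e refl) (+-idem y)

  ≤-trans : ∀ {x y z} → x ≤ y → y ≤ z → x ≤ z
  ≤-trans {x} {y} {z} p q = begin
    x + z       ≈⟨ +-cong refl (sym q) ⟩
    x + (y + z) ≈⟨ sym (+-assoc x y z) ⟩
    (x + y) + z ≈⟨ +-cong p refl ⟩
    y + z       ≈⟨ q ⟩
    z           ∎

  ≤-antisym : ∀ {x y} → x ≤ y → y ≤ x → x ≈ y
  ≤-antisym {x} {y} p q = trans (sym q) (trans (+-comm y x) p)

  ≤-respˡ : ∀ {x x′ y} → x ≈ x′ → x′ ≤ y → x ≤ y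
  ≤-respˡ e p = ≤-trans (≤-reflexive e) p

  ≤-respʳ : ∀ {x y y′} → y ≈ y′ → x ≤ y → x ≤ y′
  ≤-respʳ e p = ≤-trans p (≤-reflexive e)

  x≤x+y : ∀ {x y} → x ≤ x + y
  x≤x+y {x} {y} = begin
    x + (x + y) ≈⟨ sym (+-assoc x x y) ⟩
    (x + x) + y ≈⟨ +-cong (+-idem x) refl ⟩
    x + y       ∎

  y≤x+y : ∀ {x y} → y ≤ x + y
  y≤x+y {x} {y} = ≤-respʳ (+-comm y x) x≤x+y

  +-lub : ∀ {x y z} → x ≤ z → y ≤ z → x + y ≤ z
  +-lub {x} {y} {z} p q = begin
    (x + y) + z ≈⟨ +-assoc x y z ⟩
    x + (y + z) ≈⟨ +-cong refl q ⟩
    x + z       ≈⟨ p ⟩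
    z           ∎

  0≤ : ∀ {x} → 0# ≤ x
  0≤ {x} = +-identityˡ x

  ·-mono : ∀ {x y x′ y′} → x ≤ x′ → y ≤ y′ → x · y ≤ x′ · y′
  ·-mono {x} {y} {x′} {y′} p q = ≤-trans monoˡ monoʳ
    where
    monoˡ : x · y ≤ x′ · y
    monoˡ = trans (sym (distribʳ y x x′)) (*-cong p refl)
    monoʳ : x′ · y ≤ x′ · y′
    monoʳ = trans (sym (distribˡ x′ y y′)) (*-cong refl q)

  D-mono : ∀ {x y} → x ≤ y → D x ≤ D y
  D-mono {x} {y} p = trans (sym (D-add x y)) (D-cong p)

  ≤1⇒·ˡ-≤ : ∀ {p} y → p ≤ 1# → p · y ≤ y
  ≤1⇒·ˡ-≤ y q = ≤-respʳ (*-identityˡ y) (·-mono q (+-idem y))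

  ≤1⇒·ʳ-≤ : ∀ {p} y → p ≤ 1# → y · p ≤ y
  ≤1⇒·ʳ-≤ y q = ≤-respʳ (*-identityʳ y) (·-mono (+-idem y) q)

  D-idem : ∀ x → D (D x) ≈ D x
  D-idem x = begin
    D (D x)      ≈⟨ D-cong (sym (*-identityˡ (D x))) ⟩
    D (1# · D x) ≈⟨ sym (D-loc 1# x) ⟩
    D (1# · x)   ≈⟨ D-cong (*-identityˡ x) ⟩
    D x          ∎

  D-1 : D 1# ≈ 1#
  D-1 = trans (sym (*-identityʳ (D 1#))) (D-left 1#)

  IsTest : Carrier → Set ℓ
  IsTest p = D p ≈ p

  test≤1 : ∀ {p} → IsTest p → p ≤ 1#
  test≤1 {p} e = ≤-respˡ (sym e) (D-sub p)

  test-idem : ∀ {p} → IsTest p → p · p ≈ p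
  test-idem {p} e = trans (*-cong (sym e) refl) (D-left p)

  ≤1⇒≤D : ∀ {x} → x ≤ 1# → x ≤ D x
  ≤1⇒≤D {x} q = ≤-respˡ (sym (D-left x)) (≤1⇒·ʳ-≤ (D x) q)

  test-≤· : ∀ {z p q} → IsTest z → z ≤ p → z ≤ q → z ≤ p · q
  test-≤· e a b = ≤-respˡ (sym (test-idem e)) (·-mono a b)

  test-· : ∀ {p q} → IsTest p → IsTest q → IsTest (p · q)
  test-· {p} {q} ep eq = ≤-antisym D[pq]≤pq pq≤D[pq]
    where
    pq≤D[pq] : p · q ≤ D (p · q)
    pq≤D[pq] = ≤1⇒≤D (≤-trans (≤1⇒·ˡ-≤ q (test≤1 ep)) (test≤1 eq))
    D[pq]≤pq : D (p · q) ≤ p · q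
    D[pq]≤pq = test-≤· (D-idem (p · q))
      (≤-respʳ ep (D-mono (≤1⇒·ʳ-≤ p (test≤1 eq))))
      (≤-respʳ eq (D-mono (≤1⇒·ˡ-≤ q (test≤1 ep))))

  test-comm : ∀ {p q} → IsTest p → IsTest q → p · q ≈ q · p
  test-comm ep eq = ≤-antisym (below ep eq) (below eq ep)
    where
    below : ∀ {p q} → IsTest p → IsTest q → p · q ≤ q · p
    below {p} {q} ep eq =
      test-≤· (test-· ep eq) (≤1⇒·ˡ-≤ q (test≤1 ep)) (≤1⇒·ʳ-≤ p (test≤1 eq))

  D-test· : ∀ {p} y → IsTest p → D (p · y) ≈ p · D y
  D-test· {p} y ep = trans (D-loc p y) (test-· ep (D-idem y))

-- The equational logic of domain semirings and its term model

infix 4 _≃_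
data _≃_ : Term → Term → Set where
  ≃-refl      : ∀ {x} → x ≃ x
  ≃-sym       : ∀ {x y} → x ≃ y → y ≃ x
  ≃-trans     : ∀ {x y z} → x ≃ y → y ≃ z → x ≃ z
  ⨾-cong      : ∀ {x x′ y y′} → x ≃ x′ → y ≃ y′ → (x ⨾ y) ≃ (x′ ⨾ y′)
  ⊕-cong      : ∀ {x x′ y y′} → x ≃ x′ → y ≃ y′ → (x ⊕ y) ≃ (x′ ⊕ y′)
  dom-cong    : ∀ {x y} → x ≃ y → dom x ≃ dom y
  ⊕-assoc     : ∀ x y z → ((x ⊕ y) ⊕ z) ≃ (x ⊕ (y ⊕ z))
  ⊕-comm      : ∀ x y → (x ⊕ y) ≃ (y ⊕ x)
  ⊕-idˡ       : ∀ x → (𝟘 ⊕ x) ≃ x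
  ⊕-idʳ       : ∀ x → (x ⊕ 𝟘) ≃ x
  ⊕-idem      : ∀ x → (x ⊕ x) ≃ x
  ⨾-assoc     : ∀ x y z → ((x ⨾ y) ⨾ z) ≃ (x ⨾ (y ⨾ z))
  ⨾-idˡ       : ∀ x → (𝟙 ⨾ x) ≃ x
  ⨾-idʳ       : ∀ x → (x ⨾ 𝟙) ≃ x
  ⨾-distribˡ  : ∀ x y z → (x ⨾ (y ⊕ z)) ≃ ((x ⨾ y) ⊕ (x ⨾ z))
  ⨾-distribʳ  : ∀ x y z → ((y ⊕ z) ⨾ x) ≃ ((y ⨾ x) ⊕ (z ⨾ x))
  ⨾-zeroˡ     : ∀ x → (𝟘 ⨾ x) ≃ 𝟘
  ⨾-zeroʳ     : ∀ x → (x ⨾ 𝟘) ≃ 𝟘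
  dom-left    : ∀ x → (dom x ⨾ x) ≃ x
  dom-loc     : ∀ x y → dom (x ⨾ y) ≃ dom (x ⨾ dom y)
  dom-sub     : ∀ x → (dom x ⊕ 𝟙) ≃ 𝟙
  dom-zero    : dom 𝟘 ≃ 𝟘
  dom-add     : ∀ x y → dom (x ⊕ y) ≃ (dom x ⊕ dom y)

termAlgebra : (c ℓ : Level) → DomainSemiring c ℓ
termAlgebra c ℓ = record
  { Carrier = Lift c Term
  ; _≈_ = λ x y → Lift ℓ (lower x ≃ lower y)
  ; _+_ = λ x y → lift (lower x ⊕ lower y)
  ; _·_ = λ x y → lift (lower x ⨾ lower y)
  ; 0# = lift 𝟘
  ; 1# = lift 𝟙
  ; D = λ x → lift (dom (lower x))
  ; isSemiring = record
    { isSemiringWithoutAnnihilatingZero = record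
      { +-isCommutativeMonoid = record
        { isMonoid = record
          { isSemigroup = record
            { isMagma = record
              { isEquivalence = record
                { refl = lift ≃-refl
                ; sym = λ p → lift (≃-sym (lower p))
                ; trans = λ p q → lift (≃-trans (lower p) (lower q)) }
              ; ∙-cong = λ p q → lift (⊕-cong (lower p) (lower q)) }
            ; assoc = λ _ _ _ → lift (⊕-assoc _ _ _) }
          ; identity = (λ _ → lift (⊕-idˡ _)) , (λ _ → lift (⊕-idʳ _)) }
        ; comm = λ _ _ → lift (⊕-comm _ _) }
      ; *-cong = λ p q → lift (⨾-cong (lower p) (lower q))
      ; *-assoc = λ _ _ _ → lift (⨾-assoc _ _ _)
      ; *-identity = (λ _ → lift (⨾-idˡ _)) , (λ _ → lift (⨾-idʳ _))
      ; distrib = (λ _ _ _ → lift (⨾-distribˡ _ _ _)) , (λ _ _ _ → lift (⨾-distribʳ _ _ _)) }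
    ; zero = (λ _ → lift (⨾-zeroˡ _)) , (λ _ → lift (⨾-zeroʳ _)) }
  ; +-idem = λ _ → lift (⊕-idem _)
  ; D-cong = λ p → lift (dom-cong (lower p))
  ; D-left = λ _ → lift (dom-left _)
  ; D-loc = λ _ _ → lift (dom-loc _ _)
  ; D-sub = λ _ → lift (dom-sub _)
  ; D-zero = lift dom-zero
  ; D-add = λ _ _ → lift (dom-add _ _) }

eval-generic : ∀ {c ℓ} s → lower (⟦_⟧DS (termAlgebra c ℓ) s (λ i → lift (var i))) ≡ s
eval-generic (var i) = ≡.refl
eval-generic (s ⨾ t) = cong₂ _⨾_ (eval-generic s) (eval-generic t)
eval-generic (s ⊕ t) = cong₂ _⊕_ (eval-generic s) (eval-generic t)
eval-generic 𝟘 = ≡.refl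
eval-generic 𝟙 = ≡.refl
eval-generic (dom s) = cong dom (eval-generic s)

DSValid⇒≃ : ∀ c ℓ s t → DSValid c ℓ s t → s ≃ t
DSValid⇒≃ c ℓ s t valid =
  ≡.subst₂ _≃_ (eval-generic s) (eval-generic t)
    (lower (valid (termAlgebra c ℓ) (λ i → lift (var i))))

module RelationalSoundness {a : Level} (𝒜 : RelAlgebra a) (v : ℕ → RelAlgebra.Element 𝒜) where
  open RelAlgebra 𝒜 using (Base)

  private
    ⟦_⟧ : Term → BinRel Base
    ⟦ s ⟧ = ⟦_⟧Rel 𝒜 s v

    ≐-intro : ∀ {R S : BinRel Base} →
      (∀ {x y} → R x y → S x y) → (∀ {x y} → S x y → R x y) → R ≐ S
    ≐-intro f g x y = mk⇔ f g

  sound : ∀ {s t} → s ≃ t → ⟦ s ⟧ ≐ ⟦ t ⟧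
  sound ≃-refl x y = ⇔.refl
  sound (≃-sym p) x y = ⇔.sym (sound p x y)
  sound (≃-trans p q) x y = ⇔.trans (sound p x y) (sound q x y)
  sound (⨾-cong p q) x y = Σ-Function.congˡ {k = equivalence} λ {z} → sound p x z ×-⇔ sound q z y
  sound (⊕-cong p q) x y = sound p x y ⊎-⇔ sound q x y
  sound (dom-cong p) x y = ⇔.refl ×-⇔ Σ-Function.congˡ {k = equivalence} λ {z} → sound p x z
  sound (⊕-assoc _ _ _) = ≐-intro
    (λ { (inj₁ (inj₁ h)) → inj₁ h ; (inj₁ (inj₂ h)) → inj₂ (inj₁ h) ; (inj₂ h) → inj₂ (inj₂ h) })
    (λ { (inj₁ h) → inj₁ (inj₁ h) ; (inj₂ (inj₁ h)) → inj₁ (inj₂ h) ; (inj₂ (inj₂ h)) → inj₂ h })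
  sound (⊕-comm _ _) = ≐-intro
    (λ { (inj₁ h) → inj₂ h ; (inj₂ h) → inj₁ h })
    (λ { (inj₁ h) → inj₂ h ; (inj₂ h) → inj₁ h })
  sound (⊕-idˡ _) = ≐-intro (λ { (inj₁ ()) ; (inj₂ h) → h }) inj₂
  sound (⊕-idʳ _) = ≐-intro (λ { (inj₁ h) → h ; (inj₂ ()) }) inj₁
  sound (⊕-idem _) = ≐-intro (λ { (inj₁ h) → h ; (inj₂ h) → h }) inj₁
  sound (⨾-assoc _ _ _) = ≐-intro
    (λ { (m , (k , h₁ , h₂) , h₃) → k , h₁ , m , h₂ , h₃ })
    (λ { (k , h₁ , m , h₂ , h₃) → m , (k , h₁ , h₂) , h₃ })
  sound (⨾-idˡ _) = ≐-intro (λ { (_ , ≡.refl , h) → h }) (λ h → _ , ≡.refl , h)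
  sound (⨾-idʳ _) = ≐-intro (λ { (_ , h , ≡.refl) → h }) (λ h → _ , h , ≡.refl)
  sound (⨾-distribˡ _ _ _) = ≐-intro
    (λ { (m , h , inj₁ h′) → inj₁ (m , h , h′) ; (m , h , inj₂ h′) → inj₂ (m , h , h′) })
    (λ { (inj₁ (m , h , h′)) → m , h , inj₁ h′ ; (inj₂ (m , h , h′)) → m , h , inj₂ h′ })
  sound (⨾-distribʳ _ _ _) = ≐-intro
    (λ { (m , inj₁ h , h′) → inj₁ (m , h , h′) ; (m , inj₂ h , h′) → inj₂ (m , h , h′) })
    (λ { (inj₁ (m , h , h′)) → m , inj₁ h , h′ ; (inj₂ (m , h , h′)) → m , inj₂ h , h′ })
  sound (⨾-zeroˡ _) = ≐-intro (λ { (_ , () , _) }) λ ()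
  sound (⨾-zeroʳ _) = ≐-intro (λ { (_ , _ , ()) }) λ ()
  sound (dom-left _) = ≐-intro
    (λ { (_ , (≡.refl , _) , h) → h })
    (λ h → _ , (≡.refl , _ , h) , h)
  sound (dom-loc _ _) = ≐-intro
    (λ { (e , z , m , h₁ , h₂) → e , m , m , h₁ , ≡.refl , z , h₂ })
    (λ { (e , _ , m , h₁ , ≡.refl , k , h₂) → e , k , m , h₁ , h₂ })
  sound (dom-sub _) = ≐-intro (λ { (inj₁ (e , _)) → e ; (inj₂ e) → e }) inj₂
  sound dom-zero = ≐-intro (λ { (_ , _ , ()) }) λ ()
  sound (dom-add _ _) = ≐-intro
    (λ { (e , z , inj₁ h) → inj₁ (e , z , h) ; (e , z , inj₂ h) → inj₂ (e , z , h) })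
    (λ { (inj₁ (e , z , h)) → e , z , inj₁ h ; (inj₂ (e , z , h)) → e , z , inj₂ h })

DSValid⇒RelValid : ∀ a c ℓ s t → DSValid c ℓ s t → RelValid a s t
DSValid⇒RelValid a c ℓ s t valid 𝒜 v =
  RelationalSoundness.sound 𝒜 v (DSValid⇒≃ c ℓ s t valid)

-- Forests and paths

-- A forest is a list of branches, each a letter with a subforest.  It
-- describes a condition on a state: for each branch x c, some x-step
-- leads to a state satisfying c.
data Forest : Set where
  ε  : Forest
  br : ℕ → Forest → Forest → Forest

infixr 5 _++ᶠ_
_++ᶠ_ : Forest → Forest → Forest
ε ++ᶠ g = g
br x c f ++ᶠ g = br x c (f ++ᶠ g)

++ᶠ-assoc : ∀ f g h → (f ++ᶠ g) ++ᶠ h ≡ f ++ᶠ (g ++ᶠ h)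
++ᶠ-assoc ε g h = ≡.refl
++ᶠ-assoc (br x c f) g h = cong (br x c) (++ᶠ-assoc f g h)

-- A path is a word of letters, each position guarded by a forest.  In
-- step ls x p rs the branches ls, rs guard the position before the letter x,
-- alongside the branch x whose subforest is the domain of the rest p.
data Path : Set where
  end  : Forest → Path
  step : Forest → ℕ → Path → Forest → Path

domᶠ : Path → Forest
domᶠ (end T) = T
domᶠ (step ls x p rs) = ls ++ᶠ br x (domᶠ p) rs

lastᶠ : Path → Forest
lastᶠ (end T) = T
lastᶠ (step _ _ p _) = lastᶠ p

-- q ◁ r continues q by r, replacing the final guard of q
-- (meaningful when domᶠ r ≡ lastᶠ q)
infixr 5 _◁_
_◁_ : Path → Path → Path
end _ ◁ r = r
step ls x p rs ◁ r = step ls x (p ◁ r) rs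

◁-end : ∀ q → q ◁ end (lastᶠ q) ≡ q
◁-end (end T) = ≡.refl
◁-end (step ls x p rs) = cong (λ z → step ls x z rs) (◁-end p)

◁-assoc : ∀ q r₁ r₂ → (q ◁ r₁) ◁ r₂ ≡ q ◁ (r₁ ◁ r₂)
◁-assoc (end T) r₁ r₂ = ≡.refl
◁-assoc (step ls x p rs) r₁ r₂ = cong (λ z → step ls x z rs) (◁-assoc p r₁ r₂)

lastᶠ-◁ : ∀ q r → lastᶠ (q ◁ r) ≡ lastᶠ r
lastᶠ-◁ (end T) r = ≡.refl
lastᶠ-◁ (step ls x p rs) r = lastᶠ-◁ p r

domᶠ-◁ : ∀ q r → domᶠ r ≡ lastᶠ q → domᶠ (q ◁ r) ≡ domᶠ q
domᶠ-◁ (end T) r e = e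
domᶠ-◁ (step ls x p rs) r e = cong (λ z → ls ++ᶠ br x z rs) (domᶠ-◁ p r e)

_⋆_ : Path → Path → Path
end T ⋆ end U = end (T ++ᶠ U)
end T ⋆ step ls x p rs = step (T ++ᶠ ls) x p rs
step ls x p rs ⋆ q = step ls x (p ⋆ q) rs

-- f ⊑ g: every branch of f is matched by a branch of g with the same letter
-- whose subforest is, recursively, matched.  (g is a stronger condition.)
mutual
  data _⊑_ : Forest → Forest → Set where
    ⊑-ε  : ∀ {g} → ε ⊑ g
    ⊑-br : ∀ {x c f g} → Match x c g → f ⊑ g → br x c f ⊑ g

  data Match (x : ℕ) (c : Forest) : Forest → Set where
    here  : ∀ {c′ g} → c ⊑ c′ → Match x c (br x c′ g)
    there : ∀ {y c′ g} → Match x c g → Match x c (br y c′ g)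

⊑-weaken : ∀ {f g y c} → f ⊑ g → f ⊑ br y c g
⊑-weaken ⊑-ε = ⊑-ε
⊑-weaken (⊑-br m h) = ⊑-br (there m) (⊑-weaken h)

⊑-refl : ∀ f → f ⊑ f
⊑-refl ε = ⊑-ε
⊑-refl (br x c f) = ⊑-br (here (⊑-refl c)) (⊑-weaken (⊑-refl f))

Match-++ʳ : ∀ {x c g} h → Match x c g → Match x c (g ++ᶠ h)
Match-++ʳ h (here p) = here p
Match-++ʳ h (there m) = there (Match-++ʳ h m)

⊑-++ʳ : ∀ {f g} h → f ⊑ g → f ⊑ (g ++ᶠ h)
⊑-++ʳ h ⊑-ε = ⊑-ε
⊑-++ʳ h (⊑-br m p) = ⊑-br (Match-++ʳ h m) (⊑-++ʳ h p)

⊑-++ˡ : ∀ {f h} g → f ⊑ h → f ⊑ (g ++ᶠ h)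
⊑-++ˡ ε p = p
⊑-++ˡ (br y c g) p = ⊑-weaken (⊑-++ˡ g p)

++ᶠ-⊑ : ∀ {f g h} → f ⊑ h → g ⊑ h → (f ++ᶠ g) ⊑ h
++ᶠ-⊑ ⊑-ε q = q
++ᶠ-⊑ (⊑-br m p) q = ⊑-br m (++ᶠ-⊑ p q)

++ᶠ-⊑ˡ : ∀ f {g h} → (f ++ᶠ g) ⊑ h → f ⊑ h
++ᶠ-⊑ˡ ε p = ⊑-ε
++ᶠ-⊑ˡ (br x c f) (⊑-br m p) = ⊑-br m (++ᶠ-⊑ˡ f p)

++ᶠ-⊑ʳ : ∀ f {g h} → (f ++ᶠ g) ⊑ h → g ⊑ h
++ᶠ-⊑ʳ ε p = p
++ᶠ-⊑ʳ (br x c f) (⊑-br m p) = ++ᶠ-⊑ʳ f p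

⊑-middle : ∀ ls {x c rs h} → (ls ++ᶠ br x c rs) ⊑ h → Match x c h × (ls ++ᶠ rs) ⊑ h
⊑-middle ls p with ++ᶠ-⊑ʳ ls p
... | ⊑-br m q = m , ++ᶠ-⊑ (++ᶠ-⊑ˡ ls p) q

Match-split : ∀ {x c h} → Match x c h →
  Σ Forest λ ls → Σ Forest λ c′ → Σ Forest λ rs → h ≡ ls ++ᶠ br x c′ rs × c ⊑ c′
Match-split (here {c′} {g} p) = ε , c′ , g , ≡.refl , p
Match-split (there {y} {c′} m) with Match-split m
... | ls , c″ , rs , e , p = br y c′ ls , c″ , rs , cong (br y c′) e , p

-- p ≼ r: r runs through the same letters as p under stronger guards
data _≼_ : Path → Path → Set where
  end≼  : ∀ {T U} → T ⊑ U → end T ≼ end U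
  step≼ : ∀ {ls x p rs ls′ r rs′} →
          (ls ++ᶠ rs) ⊑ domᶠ (step ls′ x r rs′) → p ≼ r → step ls x p rs ≼ step ls′ x r rs′

≼-refl : ∀ p → p ≼ p
≼-refl (end T) = end≼ (⊑-refl T)
≼-refl (step ls x p rs) =
  step≼ (++ᶠ-⊑ (⊑-++ʳ _ (⊑-refl ls)) (⊑-++ˡ ls (⊑-weaken (⊑-refl rs)))) (≼-refl p)

≼-from-⊑ : ∀ p {U} → domᶠ p ⊑ U → Σ Path λ r → domᶠ r ≡ U × p ≼ r
≼-from-⊑ (end T) {U} h = end U , ≡.refl , end≼ h
≼-from-⊑ (step ls x p rs) h with ⊑-middle ls h
... | m , h′ with Match-split m
... | ls′ , c′ , rs′ , ≡.refl , hc with ≼-from-⊑ p hc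
... | r′ , ≡.refl , pr = step ls′ x r′ rs′ , ≡.refl , step≼ h′ pr

≼-⋆-split : ∀ p₁ p₂ {r} → (p₁ ⋆ p₂) ≼ r →
  Σ Path λ r₁ → Σ Path λ r₂ →
    r ≡ r₁ ◁ r₂ × domᶠ r₁ ≡ domᶠ r × domᶠ r₂ ≡ lastᶠ r₁ × p₁ ≼ r₁ × p₂ ≼ r₂
≼-⋆-split (end T) (end T₂) (end≼ {U = U} h) =
  end U , end U , ≡.refl , ≡.refl , ≡.refl , end≼ (++ᶠ-⊑ˡ T h) , end≼ (++ᶠ-⊑ʳ T h)
≼-⋆-split (end T) (step ls x p rs) {r} (step≼ h pr) =
  end (domᶠ r) , r , ≡.refl , ≡.refl , ≡.refl , end≼ (++ᶠ-⊑ˡ T h′) , step≼ (++ᶠ-⊑ʳ T h′) pr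
  where h′ = subst (_⊑ domᶠ r) (++ᶠ-assoc T ls rs) h
≼-⋆-split (step ls x p rs) p₂ (step≼ {ls′ = ls′} {rs′ = rs′} h pr) with ≼-⋆-split p p₂ pr
... | r₁ , r₂ , ≡.refl , e₁ , e₂ , q₁ , q₂ =
  step ls′ x r₁ rs′ , r₂ , ≡.refl , cong (λ z → ls′ ++ᶠ br x z rs′) e₁ , e₂ ,
  step≼ (subst (λ z → (ls ++ᶠ rs) ⊑ (ls′ ++ᶠ br x z rs′)) (≡.sym e₁) h) q₁ , q₂

-- Normal forms: a term as a finite sum of paths

products : List Path → List Path → List Path
products [] l₂ = []
products (p ∷ l₁) l₂ = map (p ⋆_) l₂ ++ products l₁ l₂

∈-products⁻ : ∀ {p} l₁ l₂ → p ∈ products l₁ l₂ →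
  Σ Path λ p₁ → Σ Path λ p₂ → p₁ ∈ l₁ × p₂ ∈ l₂ × p ≡ p₁ ⋆ p₂
∈-products⁻ (p₁ ∷ l₁) l₂ m with ∈-++⁻ (map (p₁ ⋆_) l₂) m
... | inj₁ m′ with ∈-map⁻ (p₁ ⋆_) m′
...   | p₂ , m₂ , e = p₁ , p₂ , here ≡.refl , m₂ , e
∈-products⁻ (p₁ ∷ l₁) l₂ m | inj₂ m′ with ∈-products⁻ l₁ l₂ m′
... | p₁′ , p₂ , m₁ , m₂ , e = p₁′ , p₂ , there m₁ , m₂ , e

letter : ℕ → Path
letter i = step ε i (end ε) ε

nf : Term → List Path
nf (var i) = letter i ∷ []
nf (s ⨾ t) = products (nf s) (nf t)
nf (s ⊕ t) = nf s ++ nf t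
nf 𝟘 = []
nf 𝟙 = end ε ∷ []
nf (dom s) = map (λ p → end (domᶠ p)) (nf s)

module PathSemantics {c ℓ : Level} (S : DomainSemiring c ℓ) (w : ℕ → DomainSemiring.Carrier S) where
  open DomainSemiring S
  open IsSemiring isSemiring
    using (+-assoc; +-cong; +-identityˡ; +-identityʳ; *-assoc; *-cong; *-identityˡ;
           *-identityʳ; distribˡ; distribʳ; zeroˡ; zeroʳ; refl; sym; trans; reflexive)
  open DomainSemiringProperties S
  open SetoidReasoning setoid

  test : Forest → Carrier
  test ε = 1#
  test (br x c f) = D (w x · test c) · test f

  ⟦_⟧ᵖ : Path → Carrier
  ⟦ end T ⟧ᵖ = test T
  ⟦ step ls x p rs ⟧ᵖ = test (ls ++ᶠ rs) · (w x · ⟦ p ⟧ᵖ)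

  sum : List Path → Carrier
  sum [] = 0#
  sum (p ∷ l) = ⟦ p ⟧ᵖ + sum l

  test-IsTest : ∀ T → IsTest (test T)
  test-IsTest ε = D-1
  test-IsTest (br x c f) = test-· (D-idem _) (test-IsTest f)

  test-++ᶠ : ∀ f g → test (f ++ᶠ g) ≈ test f · test g
  test-++ᶠ ε g = sym (*-identityˡ _)
  test-++ᶠ (br x c f) g = trans (*-cong refl (test-++ᶠ f g)) (sym (*-assoc _ _ _))

  D-path : ∀ p → D ⟦ p ⟧ᵖ ≈ test (domᶠ p)
  D-path (end T) = test-IsTest T
  D-path (step ls x p rs) = begin
    D (test (ls ++ᶠ rs) · (w x · ⟦ p ⟧ᵖ))   ≈⟨ D-test· _ (test-IsTest (ls ++ᶠ rs)) ⟩
    test (ls ++ᶠ rs) · D (w x · ⟦ p ⟧ᵖ)     ≈⟨ *-cong refl (D-loc _ _) ⟩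
    test (ls ++ᶠ rs) · D (w x · D ⟦ p ⟧ᵖ)   ≈⟨ *-cong refl (D-cong (*-cong refl (D-path p))) ⟩
    test (ls ++ᶠ rs) · d                    ≈⟨ *-cong (test-++ᶠ ls rs) refl ⟩
    (test ls · test rs) · d                 ≈⟨ *-assoc _ _ _ ⟩
    test ls · (test rs · d)                 ≈⟨ *-cong refl (test-comm (test-IsTest rs) (D-idem _)) ⟩
    test ls · (d · test rs)                 ≈⟨ sym (test-++ᶠ ls (br x (domᶠ p) rs)) ⟩
    test (ls ++ᶠ br x (domᶠ p) rs)          ∎
    where d = D (w x · test (domᶠ p))

  step-· : ∀ ls x p rs z → test (ls ++ᶠ rs) · (w x · (p · z)) ≈ (test (ls ++ᶠ rs) · (w x · p)) · z
  step-· ls x p rs z = trans (*-cong refl (sym (*-assoc _ _ _))) (sym (*-assoc _ _ _))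

  ◁-sem : ∀ q r → domᶠ r ≡ lastᶠ q → ⟦ q ◁ r ⟧ᵖ ≈ ⟦ q ⟧ᵖ · ⟦ r ⟧ᵖ
  ◁-sem (end T) r ≡.refl = trans (sym (D-left ⟦ r ⟧ᵖ)) (*-cong (D-path r) refl)
  ◁-sem (step ls x p rs) r e =
    trans (*-cong refl (*-cong refl (◁-sem p r e))) (step-· ls x ⟦ p ⟧ᵖ rs ⟦ r ⟧ᵖ)

  ⋆-sem : ∀ p q → ⟦ p ⋆ q ⟧ᵖ ≈ ⟦ p ⟧ᵖ · ⟦ q ⟧ᵖ
  ⋆-sem (end T) (end U) = test-++ᶠ T U
  ⋆-sem (end T) (step ls x p rs) = begin
    test ((T ++ᶠ ls) ++ᶠ rs) · X    ≈⟨ *-cong (reflexive (cong test (++ᶠ-assoc T ls rs))) refl ⟩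
    test (T ++ᶠ (ls ++ᶠ rs)) · X    ≈⟨ *-cong (test-++ᶠ T _) refl ⟩
    (test T · test (ls ++ᶠ rs)) · X ≈⟨ *-assoc _ _ _ ⟩
    test T · (test (ls ++ᶠ rs) · X) ∎
    where X = w x · ⟦ p ⟧ᵖ
  ⋆-sem (step ls x p rs) q =
    trans (*-cong refl (*-cong refl (⋆-sem p q))) (step-· ls x ⟦ p ⟧ᵖ rs ⟦ q ⟧ᵖ)

  sum-++ : ∀ l₁ l₂ → sum (l₁ ++ l₂) ≈ sum l₁ + sum l₂
  sum-++ [] l₂ = sym (+-identityˡ _)
  sum-++ (p ∷ l₁) l₂ = trans (+-cong refl (sum-++ l₁ l₂)) (sym (+-assoc _ _ _))

  sum-map-⋆ : ∀ p l → sum (map (p ⋆_) l) ≈ ⟦ p ⟧ᵖ · sum l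
  sum-map-⋆ p [] = sym (zeroʳ _)
  sum-map-⋆ p (q ∷ l) = trans (+-cong (⋆-sem p q) (sum-map-⋆ p l)) (sym (distribˡ _ _ _))

  sum-products : ∀ l₁ l₂ → sum (products l₁ l₂) ≈ sum l₁ · sum l₂
  sum-products [] l₂ = sym (zeroˡ _)
  sum-products (p ∷ l₁) l₂ = begin
    sum (map (p ⋆_) l₂ ++ products l₁ l₂)       ≈⟨ sum-++ (map (p ⋆_) l₂) _ ⟩
    sum (map (p ⋆_) l₂) + sum (products l₁ l₂)  ≈⟨ +-cong (sum-map-⋆ p l₂) (sum-products l₁ l₂) ⟩
    ⟦ p ⟧ᵖ · sum l₂ + sum l₁ · sum l₂           ≈⟨ sym (distribʳ _ _ _) ⟩
    (⟦ p ⟧ᵖ + sum l₁) · sum l₂                  ∎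

  sum-dom : ∀ l → D (sum l) ≈ sum (map (λ p → end (domᶠ p)) l)
  sum-dom [] = D-zero
  sum-dom (p ∷ l) = trans (D-add _ _) (+-cong (D-path p) (sum-dom l))

  normal-form : ∀ s → ⟦_⟧DS S s w ≈ sum (nf s)
  normal-form (var i) = sym (trans (+-identityʳ _) (trans (*-identityˡ _) (*-identityʳ _)))
  normal-form (s ⨾ t) = trans (*-cong (normal-form s) (normal-form t)) (sym (sum-products (nf s) (nf t)))
  normal-form (s ⊕ t) = trans (+-cong (normal-form s) (normal-form t)) (sym (sum-++ (nf s) (nf t)))
  normal-form 𝟘 = refl
  normal-form 𝟙 = sym (+-identityʳ _)
  normal-form (dom s) = trans (D-cong (normal-form s)) (sum-dom (nf s))

  sum-lub : ∀ l {z} → (∀ {p} → p ∈ l → ⟦ p ⟧ᵖ ≤ z) → sum l ≤ z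
  sum-lub [] h = 0≤
  sum-lub (p ∷ l) h = +-lub (h (here ≡.refl)) (sum-lub l (λ m → h (there m)))

-- The canonical relational model

-- States are paths; the letter i extends a path by walking down an
-- i-branch of its final guard.  All relations on the states form the algebra.
module CanonicalModel (a : Level) where

  State : Set a
  State = Lift a Path

  letterRel : ℕ → BinRel State
  letterRel i (lift q) (lift q′) = Lift a (Σ Forest λ ls → Σ Forest λ U → Σ Forest λ rs →
    lastᶠ q ≡ ls ++ᶠ br i U rs × q′ ≡ q ◁ step ls i (end U) rs)

  𝒜 : RelAlgebra a
  𝒜 = record
    { Base = State
    ; Member = λ _ → Lift (lsuc a) ⊤
    ; Member-resp = λ _ _ → lift tt
    ; ⨾-closed = λ _ _ → lift tt
    ; ∪-closed = λ _ _ → lift tt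
    ; D-closed = λ _ → lift tt
    ; ∅-mem = lift tt
    ; id-mem = lift tt }

  valuation : ℕ → RelAlgebra.Element 𝒜
  valuation i = letterRel i , lift tt

  ⟦_⟧ᶜ : Term → BinRel State
  ⟦ s ⟧ᶜ = ⟦_⟧Rel 𝒜 s valuation

  realize : ∀ s {p} → p ∈ nf s → ∀ q r → domᶠ r ≡ lastᶠ q → p ≼ r → ⟦ s ⟧ᶜ (lift q) (lift (q ◁ r))
  realize (var i) (here ≡.refl) q (step ls′ .i (end U) rs′) e (step≼ _ (end≼ _)) =
    lift (ls′ , U , rs′ , ≡.sym e , ≡.refl)
  realize (s ⨾ t) m q r e pr with ∈-products⁻ (nf s) (nf t) m
  ... | p₁ , p₂ , m₁ , m₂ , ≡.refl with ≼-⋆-split p₁ p₂ pr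
  ... | r₁ , r₂ , ≡.refl , e₁ , e₂ , q₁ , q₂ =
    lift (q ◁ r₁) , realize s m₁ q r₁ (≡.trans e₁ e) q₁ ,
    subst (λ z → ⟦ t ⟧ᶜ (lift (q ◁ r₁)) (lift z)) (◁-assoc q r₁ r₂)
      (realize t m₂ (q ◁ r₁) r₂ (≡.trans e₂ (≡.sym (lastᶠ-◁ q r₁))) q₂)
  realize (s ⊕ t) m q r e pr with ∈-++⁻ (nf s) m
  ... | inj₁ m′ = inj₁ (realize s m′ q r e pr)
  ... | inj₂ m′ = inj₂ (realize t m′ q r e pr)
  realize 𝟙 (here ≡.refl) q (end U) ≡.refl (end≼ _) = cong lift (≡.sym (◁-end q))
  realize (dom s) m q r e pr with ∈-map⁻ (λ p → end (domᶠ p)) m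
  ... | p₀ , m₀ , ≡.refl with pr
  ... | end≼ h with ≼-from-⊑ p₀ h
  ... | r₀ , e₀ , pr₀ =
    cong lift (subst (λ z → q ≡ q ◁ end z) (≡.sym e) (≡.sym (◁-end q))) ,
    lift (q ◁ r₀) , realize s m₀ q r₀ (≡.trans e₀ e) pr₀

module Completeness {c ℓ : Level} (S : DomainSemiring c ℓ) (w : ℕ → DomainSemiring.Carrier S) (a : Level) where
  open DomainSemiring S
  open IsSemiring isSemiring using (sym; trans; reflexive)
  open DomainSemiringProperties S
  open PathSemantics S w
  open CanonicalModel a

  extract : ∀ t q q′ → ⟦ t ⟧ᶜ (lift q) (lift q′) →
    Σ Path λ r → q′ ≡ q ◁ r × domᶠ r ≡ lastᶠ q × ⟦ r ⟧ᵖ ≤ ⟦_⟧DS S t w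
  extract (var i) q .(q ◁ step ls i (end U) rs) (lift (ls , U , rs , e , ≡.refl)) =
    step ls i (end U) rs , ≡.refl , ≡.sym e ,
    ≤-trans (≤1⇒·ˡ-≤ _ (test≤1 (test-IsTest (ls ++ᶠ rs)))) (≤1⇒·ʳ-≤ (w i) (test≤1 (test-IsTest U)))
  extract (s ⨾ t) q q′ (lift z , h₁ , h₂) with extract s q z h₁
  ... | r₁ , ≡.refl , e₁ , le₁ with extract t (q ◁ r₁) q′ h₂
  ... | r₂ , ≡.refl , e₂ , le₂ =
    r₁ ◁ r₂ , ◁-assoc q r₁ r₂ , ≡.trans (domᶠ-◁ r₁ r₂ e₂′) e₁ ,
    ≤-respˡ (◁-sem r₁ r₂ e₂′) (·-mono le₁ le₂)
    where e₂′ = ≡.trans e₂ (lastᶠ-◁ q r₁)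
  extract (s ⊕ t) q q′ (inj₁ h) with extract s q q′ h
  ... | r , e , e′ , le = r , e , e′ , ≤-trans le x≤x+y
  extract (s ⊕ t) q q′ (inj₂ h) with extract t q q′ h
  ... | r , e , e′ , le = r , e , e′ , ≤-trans le y≤x+y
  extract 𝟘 q q′ ()
  extract 𝟙 q .q ≡.refl =
    end (lastᶠ q) , ≡.sym (◁-end q) , ≡.refl , test≤1 (test-IsTest (lastᶠ q))
  extract (dom s) q .q (≡.refl , lift z , h) with extract s q z h
  ... | r₀ , _ , e₀ , le₀ =
    end (lastᶠ q) , ≡.sym (◁-end q) , ≡.refl ,
    ≤-respˡ (trans (reflexive (cong test (≡.sym e₀))) (sym (D-path r₀))) (D-mono le₀)

  -- Each summand p of s, realized from the state end (domᶠ p), is a move of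
  -- t by validity, so lies below t; hence so does their sum s.
  RelValid⇒≤ : ∀ s t → RelValid a s t → ⟦_⟧DS S s w ≤ ⟦_⟧DS S t w
  RelValid⇒≤ s t valid = ≤-respˡ (normal-form s) (sum-lub (nf s) summand≤t)
    where
    summand≤t : ∀ {p} → p ∈ nf s → ⟦ p ⟧ᵖ ≤ ⟦_⟧DS S t w
    summand≤t {p} m with extract t (end (domᶠ p)) p
      (Equivalence.to (valid 𝒜 valuation (lift (end (domᶠ p))) (lift p))
        (realize s m (end (domᶠ p)) p ≡.refl (≼-refl p)))
    ... | _ , ≡.refl , _ , le = le

RelValid⇒DSValid : ∀ a c ℓ s t → RelValid a s t → DSValid c ℓ s t
RelValid⇒DSValid a c ℓ s t valid S w =
  ≤-antisym (RelValid⇒≤ s t valid) (RelValid⇒≤ t s λ 𝒜 v x y → ⇔.sym (valid 𝒜 v x y))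
  where
  open DomainSemiringProperties S using (≤-antisym)
  open Completeness S w a using (RelValid⇒≤)

corollary5p9 : ∀ (a c ℓ : Level) (s t : Term) → RelValid a s t ⇔ DSValid c ℓ s t
corollary5p9 a c ℓ s t = mk⇔ (RelValid⇒DSValid a c ℓ s t) (DSValid⇒RelValid a c ℓ s t)
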